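{- Let $p\geq 1$ and $n\ge 0$ be integers. Then $$D_{\Gamma_n^p}(x,q)=\sum_{a = 0}^{\left\lfloor \frac{n+p}{p+1}\right\rfloor}\binom{n-ap+p}{a}(q+x)^{a},$$ and for all $k,d\geq 0$ the number of induced subgraphs of $\Gamma_n^p$ isomorphic to $Q_k$ whose bottom vertex is at distance $d$ from $0^n$ is $$c_{k,d}(\Gamma_n^p)=\binom{n-(k+d)p+p}{k+d}\binom{k+d}{k}.$$
   Context: For $p\geq 1$, a Fibonacci $p$-string of length $n$ is a binary string of length $n$ in which any two 1s are separated by at least $p$ 0s. The Fibonacci $p$-cube $\Gamma_n^p$ is the subgraph of the hypercube $Q_n$ (vertex set $\{0,1\}^n$, adjacency = differing in exactly one coordinate) induced by the Fibonacci $p$-strings of length $n$; $\Gamma_0^p=K_1$. Every induced subgraph $H$ of $Q_n$ isomorphic to $Q_k$ has a unique vertex of minimal Hamming weight, its bottom vertex. For a subgraph $G$ of $Q_n$ containing $0^n$, $c_{k,d}(G)$ is the number of induced subgraphs of $G$ isomorphic to $Q_k$ whose bottom vertex is at Hamming distance $d$ from $0^n$, and $D_G(x,q)=\sum_{k,d\geq0}c_{k,d}(G)x^kq^d$. Convention: $\binom{b}{a}=0$ whenever $a>b$ (in particular when $k+d>\lfloor (n+p)/(p+1)\rfloor$). -}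

module Defs where

open import Data.Nat using (ℕ; zero; suc; _+_; _*_; _∸_; _^_; _≤_; _<_)
open import Data.Nat.Combinatorics using (_C_)
open import Data.Nat.DivMod using (_/_)
open import Data.Bool using (Bool; true; false)
open import Data.Fin using (Fin; toℕ)
open import Data.Vec using (Vec; []; _∷_; lookup)
open import Data.List using (List; length)
open import Data.List.Relation.Unary.All using (All)
open import Data.List.Relation.Unary.Any using (Any)
open import Data.List.Relation.Unary.AllPairs using (AllPairs)
open import Data.Product using (Σ; ∃; _×_; _,_)
open import Relation.Binary.PropositionalEquality using (_≡_)
open import Relation.Nullary using (¬_)

Vertex : ℕ → Set
Vertex n = Vec Bool n

weight : ∀ {n} → Vertex n → ℕ
weight [] = 0
weight (true ∷ v) = suc (weight v)
weight (false ∷ v) = weight v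

hdist : ∀ {n} → Vertex n → Vertex n → ℕ
hdist [] [] = 0
hdist (true ∷ u) (true ∷ v) = hdist u v
hdist (false ∷ u) (false ∷ v) = hdist u v
hdist (true ∷ u) (false ∷ v) = suc (hdist u v)
hdist (false ∷ u) (true ∷ v) = suc (hdist u v)

Adj : ∀ {n} → Vertex n → Vertex n → Set
Adj u v = hdist u v ≡ 1

FibString : (p : ℕ) → ∀ {n} → Vertex n → Set
FibString p {n} v = (i j : Fin n) → toℕ i < toℕ j →
  lookup v i ≡ true → lookup v j ≡ true → p + toℕ i < toℕ j

VSet : ℕ → Set
VSet n = Vertex n → Bool

SameSet : ∀ {n} → VSet n → VSet n → Set
SameSet S T = ∀ v → S v ≡ T v

InducedIsoQ : (k : ℕ) → ∀ {n} → VSet n → Set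
InducedIsoQ k {n} S = Σ (Vertex k → Vertex n) λ f →
    ((u w : Vertex k) → f u ≡ f w → u ≡ w)
  × ((u : Vertex k) → S (f u) ≡ true)
  × ((v : Vertex n) → S v ≡ true → ∃ λ u → f u ≡ v)
  × ((u w : Vertex k) → (Adj u w → Adj (f u) (f w)) × (Adj (f u) (f w) → Adj u w))

-- The minimal Hamming weight over S (weight of the bottom vertex) equals d
BottomAt : ∀ {n} → ℕ → VSet n → Set
BottomAt d S = (∃ λ b → S b ≡ true × weight b ≡ d)
             × (∀ v → S v ≡ true → d ≤ weight v)

-- S is the vertex set of an induced subgraph of Γ_n^p isomorphic to Q_k
-- whose bottom vertex is at distance d from 0^n
CubeIn : (p n k d : ℕ) → VSet n → Set
CubeIn p n k d S = (∀ v → S v ≡ true → FibString p v) × InducedIsoQ k S × BottomAt d S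

-- "exactly m vertex sets satisfy P": an explicit duplicate-free enumeration
IsCount : ∀ {n} → (VSet n → Set) → ℕ → Set
IsCount {n} P m = Σ (List (VSet n)) λ L →
    All P L
  × (∀ S → P S → Any (SameSet S) L)
  × AllPairs (λ S T → ¬ SameSet S T) L
  × length L ≡ m

∑< : ℕ → (ℕ → ℕ) → ℕ
∑< zero f = 0
∑< (suc m) f = ∑< m f + f m

-- evaluation of D_G at natural numbers x, q, given the coefficients c (finitely supported in k,d ≤ n)
Deval : ℕ → (ℕ → ℕ → ℕ) → ℕ → ℕ → ℕ
Deval n c x q = ∑< (suc n) λ k → ∑< (suc n) λ d → c k d * x ^ k * q ^ d

Rhs : ℕ → ℕ → ℕ → ℕ → ℕ
Rhs p n x q = ∑< (suc ((n + p) / suc p)) λ a → ((n + p ∸ a * p) C a) * (q + x) ^ a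

{-# OPTIONS --safe #-}

-- An induced Qₖ of Qₙ is a subcube: the set of strings matching a pattern in {0,1,*}ⁿ with k stars.
-- (An injective edge-preserving map Q₁₊ₖ → Qₙ sends the edges in the first direction of Q₁₊ₖ to
-- parallel edges, since two such edges and the edges joining their ends form a square.)
-- Its bottom vertex sets every * to 0 and its top vertex sets every * to 1; as Fibonacci strings are
-- closed under turning 1s into 0s, the subcube lies in Γₙᵖ iff its top vertex is a Fibonacci string.
-- So c_{k,d} counts Fibonacci p-strings with k + d ones, k of which are marked as stars, that is
-- C(n - (k+d)p + p, k+d) C(k+d, k). Both sides obey the recurrence obtained by reading the first
-- letter of the pattern. Grouping the terms of D by a = k + d, the binomial theorem gives (q + x)ᵃ.

module Submission where

open import Defs
open import Data.Nat using (ℕ; zero; suc; pred; NonZero; +-*-rawSemiring; _+_; _*_; _∸_; _^_; _≤_; _<_; z≤n; s≤s; s≤s⁻¹; z<s)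
open import Data.Nat.Properties
open import Data.Nat.Combinatorics using (_C_; nC1≡n; nCn≡1; k>n⇒nCk≡0; nCk+nC[k+1]≡[n+1]C[k+1])
open import Data.Nat.DivMod using (_/_; _%_; m≡m%n+[m/n]*n; m%n<n)
open import Algebra.Properties.CommutativeSemigroup +-commutativeSemigroup using (interchange)
open import Algebra.Definitions.RawSemiring +-*-rawSemiring using (sum) renaming (_×_ to _×ₛ_; _^_ to _^ₛ_)
open import Algebra.Properties.Semiring.Sum +-*-semiring using (sum-cong-≗)
import Algebra.Properties.CommutativeSemiring.Binomial +-*-commutativeSemiring as Binomial
open import Data.Bool using (Bool; true; false; not)
open import Data.Bool.Properties using (not-involutive; not-¬)
open import Data.Fin using (Fin; zero; suc; toℕ)
import Data.Fin.Properties as Fin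
open import Data.Vec using (Vec; []; _∷_; lookup; map; replicate; updateAt; _[_]≔_)
open import Data.Vec.Properties
  using (∷-injectiveˡ; ∷-injectiveʳ; lookup∘updateAt; lookup∘updateAt′; lookup∘update; updateAt-updateAt; updateAt-id-local)
open import Data.List as List using (List; []; _∷_; [_]; _++_; length)
open import Data.List.Properties using (length-map; length-++)
open import Data.List.Relation.Unary.All as All using (All; []; _∷_)
import Data.List.Relation.Unary.All.Properties as All
open import Data.List.Relation.Unary.Any as Any using (Any; here)
open import Data.List.Relation.Unary.AllPairs as AllPairs using ([]; _∷_)
import Data.List.Relation.Unary.AllPairs.Properties as AllPairs
open import Data.List.Relation.Unary.Unique.Propositional using (Unique)
import Data.List.Relation.Unary.Unique.Propositional.Properties as Unique
open import Data.List.Relation.Binary.Disjoint.Propositional using (Disjoint)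
open import Data.List.Membership.Propositional using (_∈_)
open import Data.List.Membership.Propositional.Properties using (∈-map⁺; ∈-map⁻; ∈-++⁺ˡ; ∈-++⁺ʳ; ∈-++⁻)
open import Data.Product using (Σ; ∃; _×_; _,_; proj₁; proj₂)
open import Data.Sum using (_⊎_; inj₁; inj₂)
open import Data.Unit using (⊤)
open import Data.Empty using (⊥)
open import Function using (_∘_)
open import Relation.Binary.PropositionalEquality
  using (_≡_; _≢_; refl; sym; trans; cong; cong₂; subst; module ≡-Reasoning)
open import Relation.Nullary using (contradiction; yes; no)
open import Relation.Nullary.Decidable using (decidable-stable)

flip : ∀ {n} → Fin n → Vertex n → Vertex n
flip i v = updateAt v i not

flip-involutive : ∀ {n} (i : Fin n) (v : Vertex n) → flip i (flip i v) ≡ v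
flip-involutive i v = trans (updateAt-updateAt i v) (updateAt-id-local i v (not-involutive (lookup v i)))

lookup-flip : ∀ {n} (i : Fin n) (v : Vertex n) → lookup (flip i v) i ≡ not (lookup v i)
lookup-flip i v = lookup∘updateAt i v

lookup-flip-≢ : ∀ {n} {i j : Fin n} (v : Vertex n) → j ≢ i → lookup (flip i v) j ≡ lookup v j
lookup-flip-≢ {i = i} {j} v j≢i = lookup∘updateAt′ j i j≢i v

hdist-refl : ∀ {n} (v : Vertex n) → hdist v v ≡ 0
hdist-refl [] = refl
hdist-refl (true ∷ v) = hdist-refl v
hdist-refl (false ∷ v) = hdist-refl v

hdist≡0⇒≡ : ∀ {n} (u w : Vertex n) → hdist u w ≡ 0 → u ≡ w
hdist≡0⇒≡ [] [] _ = refl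
hdist≡0⇒≡ (true ∷ u) (true ∷ w) eq = cong (true ∷_) (hdist≡0⇒≡ u w eq)
hdist≡0⇒≡ (false ∷ u) (false ∷ w) eq = cong (false ∷_) (hdist≡0⇒≡ u w eq)
hdist≡0⇒≡ (true ∷ u) (false ∷ w) ()
hdist≡0⇒≡ (false ∷ u) (true ∷ w) ()

Adj⇒flip : ∀ {n} (u v : Vertex n) → Adj u v → ∃ λ i → v ≡ flip i u
Adj⇒flip [] [] ()
Adj⇒flip (true ∷ u) (true ∷ v) adj = let i , eq = Adj⇒flip u v adj in suc i , cong (true ∷_) eq
Adj⇒flip (false ∷ u) (false ∷ v) adj = let i , eq = Adj⇒flip u v adj in suc i , cong (false ∷_) eq
Adj⇒flip (true ∷ u) (false ∷ v) adj = zero , cong (false ∷_) (sym (hdist≡0⇒≡ u v (suc-injective adj)))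
Adj⇒flip (false ∷ u) (true ∷ v) adj = zero , cong (true ∷_) (sym (hdist≡0⇒≡ u v (suc-injective adj)))

Adj-false∷-true∷ : ∀ {k} (u : Vertex k) → Adj (false ∷ u) (true ∷ u)
Adj-false∷-true∷ u = cong suc (hdist-refl u)

flip²-cancel : ∀ {n} (a : Vertex n) {x s r t : Fin n} → x ≢ s → s ≢ t →
               flip x (flip s a) ≡ flip r (flip t a) → x ≡ t
flip²-cancel a {x} {s} {r} {t} x≢s s≢t eq = decidable-stable (x Fin.≟ t) λ x≢t → not-¬ refl (begin
    lookup a t                    ≡⟨ sym (lookup-flip-≢ a (s≢t ∘ sym)) ⟩
    lookup (flip s a) t           ≡⟨ sym (lookup-flip-≢ (flip s a) (x≢t ∘ sym)) ⟩
    lookup (flip x (flip s a)) t  ≡⟨ cong (λ v → lookup v t) eq ⟩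
    lookup (flip r (flip t a)) t  ≡⟨ lookup-flip-≢ (flip t a) (s≢t ∘ trans (sym r≡s) ∘ sym) ⟩
    lookup (flip t a) t           ≡⟨ lookup-flip t a ⟩
    not (lookup a t)              ∎)
  where
  open ≡-Reasoning
  r≡s : r ≡ s
  r≡s = decidable-stable (r Fin.≟ s) λ r≢s → not-¬ refl (begin
    lookup a s                    ≡⟨ sym (lookup-flip-≢ a s≢t) ⟩
    lookup (flip t a) s           ≡⟨ sym (lookup-flip-≢ (flip t a) (r≢s ∘ sym)) ⟩
    lookup (flip r (flip t a)) s  ≡⟨ cong (λ v → lookup v s) (sym eq) ⟩
    lookup (flip x (flip s a)) s  ≡⟨ lookup-flip-≢ (flip s a) (x≢s ∘ sym) ⟩
    lookup (flip s a) s           ≡⟨ lookup-flip s a ⟩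
    not (lookup a s)              ∎)

Adj-invariant⇒constant : ∀ k {A : Set} (g : Vertex k → A) → (∀ u w → Adj u w → g u ≡ g w) →
                         ∀ u → g u ≡ g (replicate k false)
Adj-invariant⇒constant zero g g-Adj [] = refl
Adj-invariant⇒constant (suc k) g g-Adj (false ∷ u) =
  Adj-invariant⇒constant k (g ∘ (false ∷_)) (λ u w → g-Adj _ _) u
Adj-invariant⇒constant (suc k) g g-Adj (true ∷ u) = begin
  g (true ∷ u)                          ≡⟨ Adj-invariant⇒constant k (g ∘ (true ∷_)) (λ u w → g-Adj _ _) u ⟩
  g (true ∷ replicate k false)          ≡⟨ sym (g-Adj _ _ (Adj-false∷-true∷ (replicate k false))) ⟩
  g (replicate (suc k) false)           ∎
  where open ≡-Reasoning

-- Subcubes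

-- A pattern in {0,1,*}ⁿ denotes the subcube of the strings that agree with it off the stars.
data Letter : Set where
  𝟎 𝟏 ⋆ : Letter

Pattern : ℕ → Set
Pattern = Vec Letter

⟦_⟧ : ∀ {n} → Pattern n → VSet n
⟦ [] ⟧ [] = true
⟦ 𝟎 ∷ P ⟧ (false ∷ v) = ⟦ P ⟧ v
⟦ 𝟎 ∷ P ⟧ (true ∷ v) = false
⟦ 𝟏 ∷ P ⟧ (false ∷ v) = false
⟦ 𝟏 ∷ P ⟧ (true ∷ v) = ⟦ P ⟧ v
⟦ ⋆ ∷ P ⟧ (b ∷ v) = ⟦ P ⟧ v

_∈⟦_⟧ : ∀ {n} → Vertex n → Pattern n → Set
v ∈⟦ P ⟧ = ⟦ P ⟧ v ≡ true

stars : ∀ {n} → Pattern n → ℕ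
stars [] = 0
stars (𝟎 ∷ P) = stars P
stars (𝟏 ∷ P) = stars P
stars (⋆ ∷ P) = suc (stars P)

ones : ∀ {n} → Pattern n → ℕ
ones [] = 0
ones (𝟎 ∷ P) = ones P
ones (𝟏 ∷ P) = suc (ones P)
ones (⋆ ∷ P) = ones P

bottom : ∀ {n} → Pattern n → Vertex n
bottom = map λ { 𝟏 → true ; _ → false }

top : ∀ {n} → Pattern n → Vertex n
top = map λ { 𝟎 → false ; _ → true }

bottom-∈ : ∀ {n} (P : Pattern n) → bottom P ∈⟦ P ⟧
bottom-∈ [] = refl
bottom-∈ (𝟎 ∷ P) = bottom-∈ P
bottom-∈ (𝟏 ∷ P) = bottom-∈ P
bottom-∈ (⋆ ∷ P) = bottom-∈ P

top-∈ : ∀ {n} (P : Pattern n) → top P ∈⟦ P ⟧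
top-∈ [] = refl
top-∈ (𝟎 ∷ P) = top-∈ P
top-∈ (𝟏 ∷ P) = top-∈ P
top-∈ (⋆ ∷ P) = top-∈ P

weight-bottom : ∀ {n} (P : Pattern n) → weight (bottom P) ≡ ones P
weight-bottom [] = refl
weight-bottom (𝟎 ∷ P) = weight-bottom P
weight-bottom (𝟏 ∷ P) = cong suc (weight-bottom P)
weight-bottom (⋆ ∷ P) = weight-bottom P

ones≤weight : ∀ {n} (P : Pattern n) (v : Vertex n) → v ∈⟦ P ⟧ → ones P ≤ weight v
ones≤weight [] [] _ = z≤n
ones≤weight (𝟎 ∷ P) (false ∷ v) v∈P = ones≤weight P v v∈P
ones≤weight (𝟏 ∷ P) (true ∷ v) v∈P = s≤s (ones≤weight P v v∈P)
ones≤weight (⋆ ∷ P) (false ∷ v) v∈P = ones≤weight P v v∈P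
ones≤weight (⋆ ∷ P) (true ∷ v) v∈P = m≤n⇒m≤1+n (ones≤weight P v v∈P)

⟦⟧-bottomAt : ∀ {n} (P : Pattern n) → BottomAt (ones P) ⟦ P ⟧
⟦⟧-bottomAt P = (bottom P , bottom-∈ P , weight-bottom P) , ones≤weight P

embed : ∀ {n} (P : Pattern n) → Vertex (stars P) → Vertex n
embed [] u = []
embed (𝟎 ∷ P) u = false ∷ embed P u
embed (𝟏 ∷ P) u = true ∷ embed P u
embed (⋆ ∷ P) (b ∷ u) = b ∷ embed P u

hdist-embed : ∀ {n} (P : Pattern n) (u w : Vertex (stars P)) → hdist (embed P u) (embed P w) ≡ hdist u w
hdist-embed [] [] [] = refl
hdist-embed (𝟎 ∷ P) u w = hdist-embed P u w
hdist-embed (𝟏 ∷ P) u w = hdist-embed P u w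
hdist-embed (⋆ ∷ P) (true ∷ u) (true ∷ w) = hdist-embed P u w
hdist-embed (⋆ ∷ P) (true ∷ u) (false ∷ w) = cong suc (hdist-embed P u w)
hdist-embed (⋆ ∷ P) (false ∷ u) (true ∷ w) = cong suc (hdist-embed P u w)
hdist-embed (⋆ ∷ P) (false ∷ u) (false ∷ w) = hdist-embed P u w

embed-∈ : ∀ {n} (P : Pattern n) (u : Vertex (stars P)) → embed P u ∈⟦ P ⟧
embed-∈ [] [] = refl
embed-∈ (𝟎 ∷ P) u = embed-∈ P u
embed-∈ (𝟏 ∷ P) u = embed-∈ P u
embed-∈ (⋆ ∷ P) (b ∷ u) = embed-∈ P u

∈⟦⟧⇒embed : ∀ {n} (P : Pattern n) (v : Vertex n) → v ∈⟦ P ⟧ → ∃ λ u → embed P u ≡ v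
∈⟦⟧⇒embed [] [] _ = [] , refl
∈⟦⟧⇒embed (𝟎 ∷ P) (false ∷ v) v∈P = let u , eq = ∈⟦⟧⇒embed P v v∈P in u , cong (false ∷_) eq
∈⟦⟧⇒embed (𝟏 ∷ P) (true ∷ v) v∈P = let u , eq = ∈⟦⟧⇒embed P v v∈P in u , cong (true ∷_) eq
∈⟦⟧⇒embed (⋆ ∷ P) (b ∷ v) v∈P = let u , eq = ∈⟦⟧⇒embed P v v∈P in b ∷ u , cong (b ∷_) eq

⟦⟧-inducedQ : ∀ {n} (P : Pattern n) → InducedIsoQ (stars P) ⟦ P ⟧
⟦⟧-inducedQ P = embed P , embed-injective , embed-∈ P , ∈⟦⟧⇒embed P ,
                λ u w → (trans (hdist-embed P u w)) , trans (sym (hdist-embed P u w))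
  where
  embed-injective : ∀ u w → embed P u ≡ embed P w → u ≡ w
  embed-injective u w eq = hdist≡0⇒≡ u w (begin
    hdist u w                    ≡⟨ sym (hdist-embed P u w) ⟩
    hdist (embed P u) (embed P w) ≡⟨ cong (hdist (embed P u)) (sym eq) ⟩
    hdist (embed P u) (embed P u) ≡⟨ hdist-refl (embed P u) ⟩
    0                            ∎)
    where open ≡-Reasoning

⟦⟧-injective : ∀ {n} (P Q : Pattern n) → SameSet ⟦ P ⟧ ⟦ Q ⟧ → P ≡ Q
⟦⟧-injective [] [] same = refl
⟦⟧-injective (𝟎 ∷ P) (𝟎 ∷ Q) same = cong (𝟎 ∷_) (⟦⟧-injective P Q (same ∘ (false ∷_)))
⟦⟧-injective (𝟏 ∷ P) (𝟏 ∷ Q) same = cong (𝟏 ∷_) (⟦⟧-injective P Q (same ∘ (true ∷_)))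
⟦⟧-injective (⋆ ∷ P) (⋆ ∷ Q) same = cong (⋆ ∷_) (⟦⟧-injective P Q (same ∘ (false ∷_)))
⟦⟧-injective (𝟎 ∷ P) (𝟏 ∷ Q) same with () ← trans (sym (bottom-∈ P)) (same (false ∷ bottom P))
⟦⟧-injective (𝟎 ∷ P) (⋆ ∷ Q) same with () ← trans (same (true ∷ bottom Q)) (bottom-∈ Q)
⟦⟧-injective (𝟏 ∷ P) (𝟎 ∷ Q) same with () ← trans (sym (bottom-∈ P)) (same (true ∷ bottom P))
⟦⟧-injective (𝟏 ∷ P) (⋆ ∷ Q) same with () ← trans (same (false ∷ bottom Q)) (bottom-∈ Q)
⟦⟧-injective (⋆ ∷ P) (𝟎 ∷ Q) same with () ← trans (sym (bottom-∈ P)) (same (true ∷ bottom P))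
⟦⟧-injective (⋆ ∷ P) (𝟏 ∷ Q) same with () ← trans (sym (bottom-∈ P)) (same (false ∷ bottom P))

-- Induced cubes are subcubes

fromVertex : ∀ {n} → Vertex n → Pattern n
fromVertex = map λ { false → 𝟎 ; true → 𝟏 }

stars-fromVertex : ∀ {n} (v : Vertex n) → stars (fromVertex v) ≡ 0
stars-fromVertex [] = refl
stars-fromVertex (false ∷ v) = stars-fromVertex v
stars-fromVertex (true ∷ v) = stars-fromVertex v

fromVertex-∈ : ∀ {n} (v : Vertex n) → v ∈⟦ fromVertex v ⟧
fromVertex-∈ [] = refl
fromVertex-∈ (false ∷ v) = fromVertex-∈ v
fromVertex-∈ (true ∷ v) = fromVertex-∈ v

∈-fromVertex⇒≡ : ∀ {n} (v w : Vertex n) → w ∈⟦ fromVertex v ⟧ → v ≡ w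
∈-fromVertex⇒≡ [] [] _ = refl
∈-fromVertex⇒≡ (false ∷ v) (false ∷ w) w∈ = cong (false ∷_) (∈-fromVertex⇒≡ v w w∈)
∈-fromVertex⇒≡ (true ∷ v) (true ∷ w) w∈ = cong (true ∷_) (∈-fromVertex⇒≡ v w w∈)

∈-[]≔⋆ : ∀ {n} (i : Fin n) (P : Pattern n) (v : Vertex n) → v ∈⟦ P ⟧ → v ∈⟦ P [ i ]≔ ⋆ ⟧
∈-[]≔⋆ zero (𝟎 ∷ P) (false ∷ v) v∈P = v∈P
∈-[]≔⋆ zero (𝟏 ∷ P) (true ∷ v) v∈P = v∈P
∈-[]≔⋆ zero (⋆ ∷ P) (b ∷ v) v∈P = v∈P
∈-[]≔⋆ (suc i) (𝟎 ∷ P) (false ∷ v) v∈P = ∈-[]≔⋆ i P v v∈P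
∈-[]≔⋆ (suc i) (𝟏 ∷ P) (true ∷ v) v∈P = ∈-[]≔⋆ i P v v∈P
∈-[]≔⋆ (suc i) (⋆ ∷ P) (b ∷ v) v∈P = ∈-[]≔⋆ i P v v∈P

∈-[]≔⋆⁻ : ∀ {n} (i : Fin n) (P : Pattern n) (v : Vertex n) →
          v ∈⟦ P [ i ]≔ ⋆ ⟧ → v ∈⟦ P ⟧ ⊎ flip i v ∈⟦ P ⟧
∈-[]≔⋆⁻ zero (𝟎 ∷ P) (false ∷ v) v∈ = inj₁ v∈
∈-[]≔⋆⁻ zero (𝟎 ∷ P) (true ∷ v) v∈ = inj₂ v∈
∈-[]≔⋆⁻ zero (𝟏 ∷ P) (false ∷ v) v∈ = inj₂ v∈
∈-[]≔⋆⁻ zero (𝟏 ∷ P) (true ∷ v) v∈ = inj₁ v∈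
∈-[]≔⋆⁻ zero (⋆ ∷ P) (b ∷ v) v∈ = inj₁ v∈
∈-[]≔⋆⁻ (suc i) (𝟎 ∷ P) (false ∷ v) v∈ = ∈-[]≔⋆⁻ i P v v∈
∈-[]≔⋆⁻ (suc i) (𝟏 ∷ P) (true ∷ v) v∈ = ∈-[]≔⋆⁻ i P v v∈
∈-[]≔⋆⁻ (suc i) (⋆ ∷ P) (b ∷ v) v∈ = ∈-[]≔⋆⁻ i P v v∈

flip-∈⋆ : ∀ {n} (i : Fin n) (P : Pattern n) (v : Vertex n) → lookup P i ≡ ⋆ → v ∈⟦ P ⟧ → flip i v ∈⟦ P ⟧
flip-∈⋆ zero (⋆ ∷ P) (b ∷ v) _ v∈P = v∈P
flip-∈⋆ (suc i) (𝟎 ∷ P) (false ∷ v) Pi≡⋆ v∈P = flip-∈⋆ i P v Pi≡⋆ v∈P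
flip-∈⋆ (suc i) (𝟏 ∷ P) (true ∷ v) Pi≡⋆ v∈P = flip-∈⋆ i P v Pi≡⋆ v∈P
flip-∈⋆ (suc i) (⋆ ∷ P) (b ∷ v) Pi≡⋆ v∈P = flip-∈⋆ i P v Pi≡⋆ v∈P

stars-[]≔⋆ : ∀ {n} (i : Fin n) (P : Pattern n) → lookup P i ≢ ⋆ → stars (P [ i ]≔ ⋆) ≡ suc (stars P)
stars-[]≔⋆ zero (𝟎 ∷ P) _ = refl
stars-[]≔⋆ zero (𝟏 ∷ P) _ = refl
stars-[]≔⋆ zero (⋆ ∷ P) Pi≢⋆ = contradiction refl Pi≢⋆
stars-[]≔⋆ (suc i) (𝟎 ∷ P) Pi≢⋆ = stars-[]≔⋆ i P Pi≢⋆
stars-[]≔⋆ (suc i) (𝟏 ∷ P) Pi≢⋆ = stars-[]≔⋆ i P Pi≢⋆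
stars-[]≔⋆ (suc i) (⋆ ∷ P) Pi≢⋆ = cong suc (stars-[]≔⋆ i P Pi≢⋆)

record IsImage {k n} (f : Vertex k → Vertex n) (P : Pattern n) : Set where
  field
    image-∈ : ∀ u → f u ∈⟦ P ⟧
    ∈-image : ∀ v → v ∈⟦ P ⟧ → ∃ λ u → f u ≡ v

module CubeEmbedding {k n} (f : Vertex (suc k) → Vertex n)
                     (f-injective : ∀ u w → f u ≡ f w → u ≡ w)
                     (f-Adj : ∀ u w → Adj u w → Adj (f u) (f w)) where

  f₀ f₁ : Vertex k → Vertex n
  f₀ = f ∘ (false ∷_)
  f₁ = f ∘ (true ∷_)

  f₀≢f₁ : ∀ u w → f₀ u ≢ f₁ w
  f₀≢f₁ u w eq with () ← f-injective _ _ eq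

  rung : ∀ u → ∃ λ i → f₁ u ≡ flip i (f₀ u)
  rung u = Adj⇒flip (f₀ u) (f₁ u) (f-Adj _ _ (Adj-false∷-true∷ u))

  direction : Vertex k → Fin n
  direction = proj₁ ∘ rung

  direction-Adj : ∀ u w → Adj u w → direction u ≡ direction w
  direction-Adj u w adj with Adj⇒flip (f₀ u) (f₀ w) (f-Adj _ _ adj)
                            | Adj⇒flip (f₁ u) (f₁ w) (f-Adj (true ∷ u) (true ∷ w) adj)
  ... | s , f₀w≡ | r , f₁w≡ = sym (flip²-cancel (f₀ u) dw≢s s≢du square)
    where
    open ≡-Reasoning
    square : flip (direction w) (flip s (f₀ u)) ≡ flip r (flip (direction u) (f₀ u))
    square = begin
      flip (direction w) (flip s (f₀ u))   ≡⟨ cong (flip (direction w)) f₀w≡ ⟨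
      flip (direction w) (f₀ w)            ≡⟨ proj₂ (rung w) ⟨
      f₁ w                                 ≡⟨ f₁w≡ ⟩
      flip r (f₁ u)                        ≡⟨ cong (flip r) (proj₂ (rung u)) ⟩
      flip r (flip (direction u) (f₀ u))   ∎
    dw≢s : direction w ≢ s
    dw≢s eq = f₀≢f₁ u w (begin
      f₀ u                                 ≡⟨ flip-involutive s (f₀ u) ⟨
      flip s (flip s (f₀ u))               ≡⟨ cong (λ i → flip i (flip s (f₀ u))) eq ⟨
      flip (direction w) (flip s (f₀ u))   ≡⟨ cong (flip (direction w)) f₀w≡ ⟨
      flip (direction w) (f₀ w)            ≡⟨ proj₂ (rung w) ⟨
      f₁ w                                 ∎)
    s≢du : s ≢ direction u
    s≢du eq = f₀≢f₁ w u (trans f₀w≡ (trans (cong (λ i → flip i (f₀ u)) eq) (sym (proj₂ (rung u)))))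

  axis : Fin n
  axis = direction (replicate k false)

  f₁≡flip-axis : ∀ u → f₁ u ≡ flip axis (f₀ u)
  f₁≡flip-axis u = trans (proj₂ (rung u)) (cong (λ i → flip i (f₀ u)) (Adj-invariant⇒constant k direction direction-Adj u))

  module _ {P₀ : Pattern n} (img₀ : IsImage f₀ P₀) where
    open IsImage img₀

    axis-not-⋆ : lookup P₀ axis ≢ ⋆
    axis-not-⋆ P₀-axis≡⋆
      with ∈-image _ (flip-∈⋆ axis P₀ (f₀ o) P₀-axis≡⋆ (image-∈ o)) where o = replicate k false
    ... | u , f₀u≡ = f₀≢f₁ u _ (trans f₀u≡ (sym (f₁≡flip-axis _)))

    image-[]≔⋆ : IsImage f (P₀ [ axis ]≔ ⋆)
    image-[]≔⋆ = record { image-∈ = image-∈′ ; ∈-image = ∈-image′ }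
      where
      image-∈′ : ∀ u → f u ∈⟦ P₀ [ axis ]≔ ⋆ ⟧
      image-∈′ (false ∷ u) = ∈-[]≔⋆ axis P₀ _ (image-∈ u)
      image-∈′ (true ∷ u) = subst (_∈⟦ P₀ [ axis ]≔ ⋆ ⟧) (sym (f₁≡flip-axis u))
        (flip-∈⋆ axis (P₀ [ axis ]≔ ⋆) _ (lookup∘update axis P₀ ⋆) (∈-[]≔⋆ axis P₀ _ (image-∈ u)))
      ∈-image′ : ∀ v → v ∈⟦ P₀ [ axis ]≔ ⋆ ⟧ → ∃ λ u → f u ≡ v
      ∈-image′ v v∈ with ∈-[]≔⋆⁻ axis P₀ v v∈
      ... | inj₁ v∈P₀ = let u , f₀u≡v = ∈-image v v∈P₀ in false ∷ u , f₀u≡v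
      ... | inj₂ flip-v∈P₀ = let u , f₀u≡ = ∈-image _ flip-v∈P₀ in
        true ∷ u , trans (f₁≡flip-axis u) (trans (cong (flip axis) f₀u≡) (flip-involutive axis v))

embedding⇒subcube : ∀ k {n} (f : Vertex k → Vertex n) →
                    (∀ u w → f u ≡ f w → u ≡ w) → (∀ u w → Adj u w → Adj (f u) (f w)) →
                    ∃ λ P → stars P ≡ k × IsImage f P
embedding⇒subcube zero f _ _ = fromVertex (f []) , stars-fromVertex (f []) , record
  { image-∈ = λ { [] → fromVertex-∈ (f []) }
  ; ∈-image = λ v v∈ → [] , ∈-fromVertex⇒≡ (f []) v v∈
  }
embedding⇒subcube (suc k) f f-injective f-Adj
  with embedding⇒subcube k f₀ (λ u w → ∷-injectiveʳ ∘ f-injective _ _) (λ u w → f-Adj _ _)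
  where open CubeEmbedding f f-injective f-Adj
... | P₀ , stars-P₀ , img₀ =
  P₀ [ axis ]≔ ⋆ , trans (stars-[]≔⋆ axis P₀ (axis-not-⋆ img₀)) (cong suc stars-P₀) , image-[]≔⋆ img₀
  where open CubeEmbedding f f-injective f-Adj

-- Fibonacci strings

module Fibonacci (p : ℕ) where

  -- `FibFrom g v`: v is a Fibonacci p-string that starts with at least g zeros.
  FibFrom : ∀ {n} → ℕ → Vertex n → Set
  FibFrom g [] = ⊤
  FibFrom g (false ∷ v) = FibFrom (pred g) v
  FibFrom zero (true ∷ v) = FibFrom p v
  FibFrom (suc g) (true ∷ v) = ⊥

  FibFrom-mono : ∀ {n g h} (v : Vertex n) → h ≤ g → FibFrom g v → FibFrom h v
  FibFrom-mono [] _ _ = _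
  FibFrom-mono (false ∷ v) h≤g fib = FibFrom-mono v (pred-mono-≤ h≤g) fib
  FibFrom-mono {g = zero} {zero} (true ∷ v) _ fib = fib

  FibFrom-⟦⟧ : ∀ {n} g (P : Pattern n) (v : Vertex n) → v ∈⟦ P ⟧ → FibFrom g (top P) → FibFrom g v
  FibFrom-⟦⟧ g [] [] _ _ = _
  FibFrom-⟦⟧ g (𝟎 ∷ P) (false ∷ v) v∈P fib = FibFrom-⟦⟧ (pred g) P v v∈P fib
  FibFrom-⟦⟧ zero (𝟏 ∷ P) (true ∷ v) v∈P fib = FibFrom-⟦⟧ p P v v∈P fib
  FibFrom-⟦⟧ zero (⋆ ∷ P) (true ∷ v) v∈P fib = FibFrom-⟦⟧ p P v v∈P fib
  FibFrom-⟦⟧ zero (⋆ ∷ P) (false ∷ v) v∈P fib = FibFrom-⟦⟧ zero P v v∈P (FibFrom-mono (top P) z≤n fib)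

  FibFrom⇒leading-zeros : ∀ {n} g (v : Vertex n) → FibFrom g v → ∀ j → lookup v j ≡ true → g ≤ toℕ j
  FibFrom⇒leading-zeros zero _ _ _ _ = z≤n
  FibFrom⇒leading-zeros (suc g) (false ∷ v) fib (suc j) vj≡1 = s≤s (FibFrom⇒leading-zeros g v fib j vj≡1)

  FibString-∷ : ∀ {n} b (v : Vertex n) → FibString p v →
                (b ≡ true → ∀ j → lookup v j ≡ true → p ≤ toℕ j) → FibString p (b ∷ v)
  FibString-∷ b v fib lead zero (suc j) _ b≡1 vj≡1 =
    s≤s (subst (_≤ toℕ j) (sym (+-identityʳ p)) (lead b≡1 j vj≡1))
  FibString-∷ b v fib lead (suc i) (suc j) i<j vi≡1 vj≡1 =
    subst (_< suc (toℕ j)) (sym (+-suc p (toℕ i))) (s≤s (fib i j (s≤s⁻¹ i<j) vi≡1 vj≡1))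

  FibString-tail : ∀ {n} b (v : Vertex n) → FibString p (b ∷ v) → FibString p v
  FibString-tail b v fib i j i<j vi≡1 vj≡1 =
    s≤s⁻¹ (subst (_< suc (toℕ j)) (+-suc p (toℕ i)) (fib (suc i) (suc j) (s≤s i<j) vi≡1 vj≡1))

  FibString-head : ∀ {n} (v : Vertex n) → FibString p (true ∷ v) → ∀ j → lookup v j ≡ true → p ≤ toℕ j
  FibString-head v fib j vj≡1 = s≤s⁻¹ (subst (_< suc (toℕ j)) (+-identityʳ p) (fib zero (suc j) z<s refl vj≡1))

  FibFrom⇒FibString : ∀ {n} g (v : Vertex n) → FibFrom g v → FibString p v
  FibFrom⇒FibString g (false ∷ v) fib =
    FibString-∷ false v (FibFrom⇒FibString (pred g) v fib) λ ()
  FibFrom⇒FibString zero (true ∷ v) fib =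
    FibString-∷ true v (FibFrom⇒FibString p v fib) λ _ → FibFrom⇒leading-zeros p v fib

  FibString⇒FibFrom : ∀ {n} g (v : Vertex n) → FibString p v →
                      (∀ j → lookup v j ≡ true → g ≤ toℕ j) → FibFrom g v
  FibString⇒FibFrom g [] _ _ = _
  FibString⇒FibFrom g (false ∷ v) fib lead =
    FibString⇒FibFrom (pred g) v (FibString-tail false v fib) (λ j vj≡1 → pred-mono-≤ (lead (suc j) vj≡1))
  FibString⇒FibFrom zero (true ∷ v) fib lead =
    FibString⇒FibFrom p v (FibString-tail true v fib) (FibString-head v fib)
  FibString⇒FibFrom (suc g) (true ∷ v) fib lead with () ← lead zero refl

-- The closed form and its recurrence

-- the number of Fibonacci p-strings of length n with a ones
fibCount : ℕ → ℕ → ℕ → ℕ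
fibCount p n a = (n + p ∸ a * p) C a

cubeCount : ℕ → ℕ → ℕ → ℕ → ℕ
cubeCount p n k d = fibCount p n (k + d) * ((k + d) C k)

m+n∸[n+o]≡m∸o : ∀ m n o → m + n ∸ (n + o) ≡ m ∸ o
m+n∸[n+o]≡m∸o m n o = trans (cong (_∸ (n + o)) (+-comm m n)) ([m+n]∸[m+o]≡n∸o n m o)

-- Pascal's rule survives truncated subtraction once the lower index is at least 2.
[1+m∸t]C[2+a]≡[m∸t]C[2+a]+[m∸t]C[1+a] : ∀ m t a →
  (suc m ∸ t) C suc (suc a) ≡ (m ∸ t) C suc (suc a) + (m ∸ t) C suc a
[1+m∸t]C[2+a]≡[m∸t]C[2+a]+[m∸t]C[1+a] m t a with t ≤? m
... | yes t≤m rewrite +-∸-assoc 1 t≤m =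
  sym (trans (+-comm ((m ∸ t) C suc (suc a)) _) (nCk+nC[k+1]≡[n+1]C[k+1] (m ∸ t) (suc a)))
... | no t≰m rewrite m≤n⇒m∸n≡0 (≰⇒> t≰m) | m≤n⇒m∸n≡0 (<⇒≤ (≰⇒> t≰m)) = refl

fibCount-suc : ∀ p n a → fibCount p (suc n) (suc a) ≡ fibCount p n (suc a) + fibCount p (n ∸ p) a
fibCount-suc p n zero = begin
  (suc n + p ∸ (p + 0)) C 1      ≡⟨ cong (_C 1) (m+n∸[n+o]≡m∸o (suc n) p 0) ⟩
  suc n C 1                      ≡⟨ nC1≡n (suc n) ⟩
  suc n                          ≡⟨ +-comm 1 n ⟩
  n + 1                          ≡⟨ cong (_+ 1) (trans (cong (_C 1) (m+n∸[n+o]≡m∸o n p 0)) (nC1≡n n)) ⟨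
  (n + p ∸ (p + 0)) C 1 + 1      ∎
  where open ≡-Reasoning
fibCount-suc p n (suc a) = begin
  (suc n + p ∸ (p + t)) C suc (suc a)           ≡⟨ cong (_C suc (suc a)) (m+n∸[n+o]≡m∸o (suc n) p t) ⟩
  (suc n ∸ t) C suc (suc a)                     ≡⟨ [1+m∸t]C[2+a]≡[m∸t]C[2+a]+[m∸t]C[1+a] n t a ⟩
  (n ∸ t) C suc (suc a) + (n ∸ t) C suc a       ≡⟨ cong₂ _+_ (cong (_C suc (suc a)) (m+n∸[n+o]≡m∸o n p t))
                                                             (cong (_C suc a) n∸p+p∸t≡n∸t) ⟨
  (n + p ∸ (p + t)) C suc (suc a) + (n ∸ p + p ∸ t) C suc a ∎
  where
  open ≡-Reasoning
  t : ℕ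
  t = suc a * p
  n∸p+p∸t≡n∸t : n ∸ p + p ∸ t ≡ n ∸ t
  n∸p+p∸t≡n∸t = trans (m+n∸[n+o]≡m∸o (n ∸ p) p (a * p)) (∸-+-assoc n p (a * p))

fibCount-suc-* : ∀ p n a c → fibCount p (suc n) (suc a) * c ≡ fibCount p n (suc a) * c + fibCount p (n ∸ p) a * c
fibCount-suc-* p n a c = trans (cong (_* c) (fibCount-suc p n a)) (*-distribʳ-+ c (fibCount p n (suc a)) _)

whenSuc : ∀ {A : Set} → A → (ℕ → A) → ℕ → A
whenSuc z h zero = z
whenSuc z h (suc m) = h m

-- A subcube of Γₙ₊₁ᵖ starts with 0, or with 1 or * followed by p zeros.
cubeCount-suc : ∀ p n k d → cubeCount p (suc n) k d ≡
  cubeCount p n k d + (whenSuc 0 (cubeCount p (n ∸ p) k) d + whenSuc 0 (λ k′ → cubeCount p (n ∸ p) k′ d) k)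
cubeCount-suc p n zero zero = refl
cubeCount-suc p n zero (suc d) =
  trans (fibCount-suc-* p n d 1) (cong (cubeCount p n 0 (suc d) +_) (sym (+-identityʳ _)))
cubeCount-suc p n (suc k) zero =
  trans (fibCount-suc-* p n (k + 0) _) (cong (λ c → cubeCount p n (suc k) 0 + fibCount p (n ∸ p) (k + 0) * c) C-eq)
  where
  C-eq : suc (k + 0) C suc k ≡ (k + 0) C k
  C-eq = subst (λ m → suc m C suc k ≡ m C k) (sym (+-identityʳ k)) (trans (nCn≡1 (suc k)) (sym (nCn≡1 k)))
cubeCount-suc p n (suc k) (suc d) =
  trans (fibCount-suc-* p n s _) (cong (cubeCount p n (suc k) (suc d) +_) split)
  where
  open ≡-Reasoning
  s : ℕ
  s = k + suc d
  f : ℕ → ℕ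
  f = fibCount p (n ∸ p)
  split : f s * (suc s C suc k) ≡ cubeCount p (n ∸ p) (suc k) d + cubeCount p (n ∸ p) k (suc d)
  split = begin
    f s * (suc s C suc k)               ≡⟨ cong (f s *_) (nCk+nC[k+1]≡[n+1]C[k+1] s k) ⟨
    f s * (s C k + s C suc k)           ≡⟨ *-distribˡ-+ (f s) (s C k) _ ⟩
    f s * (s C k) + f s * (s C suc k)   ≡⟨ +-comm (f s * (s C k)) _ ⟩
    f s * (s C suc k) + f s * (s C k)   ≡⟨ cong (λ a → f a * (a C suc k) + f s * (s C k)) (+-suc k d) ⟩
    f (suc k + d) * ((suc k + d) C suc k) + f s * (s C k) ∎

fibCount-vanish : ∀ p n a → n + p < a * suc p → fibCount p n a ≡ 0
fibCount-vanish p n (suc a) lt =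
  k>n⇒nCk≡0 (m<n+o⇒m∸n<o (n + p) (suc a * p) (subst (n + p <_) (trans (*-suc (suc a) p) (+-comm (suc a) _)) lt))

fibCount-vanish-< : ∀ p n a → n < a → fibCount p n a ≡ 0
fibCount-vanish-< p n a n<a = fibCount-vanish p n a (begin-strict
  n + p              ≡⟨ +-comm n p ⟩
  p + n              ≤⟨ +-monoʳ-≤ p (m≤m*n n (suc p)) ⟩
  p + n * suc p      <⟨ n<1+n _ ⟩
  suc n * suc p      ≤⟨ *-monoˡ-≤ (suc p) n<a ⟩
  a * suc p          ∎)
  where open ≤-Reasoning

m<[1+m/n]*n : ∀ m n .{{_ : NonZero n}} → m < suc (m / n) * n
m<[1+m/n]*n m n = begin-strict
  m                  ≡⟨ m≡m%n+[m/n]*n m n ⟩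
  m % n + m / n * n  <⟨ +-monoˡ-< (m / n * n) (m%n<n m n) ⟩
  n + m / n * n      ≡⟨⟩
  suc (m / n) * n    ∎
  where open ≤-Reasoning

fibCount-vanish-/ : ∀ p n a → (n + p) / suc p < a → fibCount p n a ≡ 0
fibCount-vanish-/ p n a lt =
  fibCount-vanish p n a (<-≤-trans (m<[1+m/n]*n (n + p) (suc p)) (*-monoˡ-≤ (suc p) lt))

cubeCount-vanish : ∀ p n k d → n < k + d → cubeCount p n k d ≡ 0
cubeCount-vanish p n k d n<k+d = cong (_* ((k + d) C k)) (fibCount-vanish-< p n (k + d) n<k+d)

-- Enumerating the subcubes of Γₙᵖ

Bool-ext : ∀ {a b : Bool} → (a ≡ true → b ≡ true) → (b ≡ true → a ≡ true) → a ≡ b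
Bool-ext {true} a⇒b _ = sym (a⇒b refl)
Bool-ext {false} {false} _ _ = refl
Bool-ext {false} {true} _ b⇒a = b⇒a refl

map-disjoint : ∀ {A B : Set} {f g : A → B} {xs ys : List A} →
               (∀ x y → f x ≢ g y) → Disjoint (List.map f xs) (List.map g ys)
map-disjoint {f = f} {g} f≢g (v∈fxs , v∈gys) with ∈-map⁻ f v∈fxs | ∈-map⁻ g v∈gys
... | x , _ , refl | y , _ , fx≡gy = f≢g x y fx≡gy

Disjoint-++ʳ : ∀ {A : Set} {xs ys zs : List A} → Disjoint xs ys → Disjoint xs zs → Disjoint xs (ys ++ zs)
Disjoint-++ʳ {ys = ys} xs#ys xs#zs (v∈xs , v∈ys++zs) with ∈-++⁻ ys v∈ys++zs
... | inj₁ v∈ys = xs#ys (v∈xs , v∈ys)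
... | inj₂ v∈zs = xs#zs (v∈xs , v∈zs)

heads-differ : ∀ {n} {a b : Letter} → a ≢ b → ∀ (P Q : Pattern n) → a ∷ P ≢ b ∷ Q
heads-differ a≢b P Q = a≢b ∘ ∷-injectiveˡ

module Subcubes (p : ℕ) where
  open Fibonacci p

  Admissible : ℕ → ℕ → ℕ → ∀ {n} → Pattern n → Set
  Admissible g k d P = FibFrom g (top P) × stars P ≡ k × ones P ≡ d

  subcubes : ℕ → (n : ℕ) → ℕ → ℕ → List (Pattern n)
  subcubes g zero zero zero = [ [] ]
  subcubes g zero zero (suc d) = []
  subcubes g zero (suc k) d = []
  subcubes (suc g) (suc n) k d = List.map (𝟎 ∷_) (subcubes g n k d)
  subcubes zero (suc n) k d =
    List.map (𝟎 ∷_) (subcubes zero n k d) ++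
    List.map (𝟏 ∷_) (whenSuc [] (subcubes p n k) d) ++
    List.map (⋆ ∷_) (whenSuc [] (λ k′ → subcubes p n k′ d) k)

  subcubes-sound : ∀ g n k d → All (Admissible g k d) (subcubes g n k d)
  subcubes-sound g zero zero zero = (_ , refl , refl) ∷ []
  subcubes-sound g zero zero (suc d) = []
  subcubes-sound g zero (suc k) d = []
  subcubes-sound (suc g) (suc n) k d = All.map⁺ (subcubes-sound g n k d)
  subcubes-sound zero (suc n) k d =
    All.++⁺ (All.map⁺ (subcubes-sound zero n k d)) (All.++⁺ (All.map⁺ (after-𝟏 d)) (All.map⁺ (after-⋆ k)))
    where
    after-𝟏 : ∀ d → All (Admissible zero k d ∘ (𝟏 ∷_)) (whenSuc [] (subcubes p n k) d)
    after-𝟏 zero = []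
    after-𝟏 (suc d) = All.map (λ (fib , stars≡ , ones≡) → fib , stars≡ , cong suc ones≡) (subcubes-sound p n k d)
    after-⋆ : ∀ k → All (Admissible zero k d ∘ (⋆ ∷_)) (whenSuc [] (λ k′ → subcubes p n k′ d) k)
    after-⋆ zero = []
    after-⋆ (suc k) = All.map (λ (fib , stars≡ , ones≡) → fib , cong suc stars≡ , ones≡) (subcubes-sound p n k d)

  subcubes-complete : ∀ g {n} (P : Pattern n) → FibFrom g (top P) → P ∈ subcubes g n (stars P) (ones P)
  subcubes-complete g [] _ = here refl
  subcubes-complete (suc g) (𝟎 ∷ P) fib = ∈-map⁺ (𝟎 ∷_) (subcubes-complete g P fib)
  subcubes-complete zero (𝟎 ∷ P) fib = ∈-++⁺ˡ (∈-map⁺ (𝟎 ∷_) (subcubes-complete zero P fib))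
  subcubes-complete zero {suc n} (𝟏 ∷ P) fib =
    ∈-++⁺ʳ (List.map (𝟎 ∷_) (subcubes zero n (stars P) (suc (ones P))))
           (∈-++⁺ˡ (∈-map⁺ (𝟏 ∷_) (subcubes-complete p P fib)))
  subcubes-complete zero {suc n} (⋆ ∷ P) fib =
    ∈-++⁺ʳ (List.map (𝟎 ∷_) (subcubes zero n (suc (stars P)) (ones P)))
           (∈-++⁺ʳ (List.map (𝟏 ∷_) (whenSuc [] (subcubes p n (suc (stars P))) (ones P)))
                   (∈-map⁺ (⋆ ∷_) (subcubes-complete p P fib)))

  subcubes-unique : ∀ g n k d → Unique (subcubes g n k d)
  subcubes-unique g zero zero zero = [] ∷ []
  subcubes-unique g zero zero (suc d) = []
  subcubes-unique g zero (suc k) d = []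
  subcubes-unique (suc g) (suc n) k d = Unique.map⁺ ∷-injectiveʳ (subcubes-unique g n k d)
  subcubes-unique zero (suc n) k d =
    Unique.++⁺ (Unique.map⁺ ∷-injectiveʳ (subcubes-unique zero n k d))
      (Unique.++⁺ (Unique.map⁺ ∷-injectiveʳ (after-𝟏 d)) (Unique.map⁺ ∷-injectiveʳ (after-⋆ k))
                  (map-disjoint (heads-differ λ ())))
      (Disjoint-++ʳ {ys = List.map (𝟏 ∷_) (whenSuc [] (subcubes p n k) d)}
                    (map-disjoint (heads-differ λ ())) (map-disjoint (heads-differ λ ())))
    where
    after-𝟏 : ∀ d → Unique (whenSuc [] (subcubes p n k) d)
    after-𝟏 zero = []
    after-𝟏 (suc d) = subcubes-unique p n k d
    after-⋆ : ∀ k → Unique (whenSuc [] (λ k′ → subcubes p n k′ d) k)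
    after-⋆ zero = []
    after-⋆ (suc k) = subcubes-unique p n k d

  length-subcubes : ∀ g n k d → length (subcubes g n k d) ≡ cubeCount p (n ∸ g) k d
  length-subcubes g zero zero zero = refl
  length-subcubes g zero zero (suc d) = sym (cubeCount-vanish p (0 ∸ g) 0 (suc d) (s≤s (≤-trans (m∸n≤m 0 g) z≤n)))
  length-subcubes g zero (suc k) d = sym (cubeCount-vanish p (0 ∸ g) (suc k) d (s≤s (≤-trans (m∸n≤m 0 g) z≤n)))
  length-subcubes (suc g) (suc n) k d = trans (length-map (𝟎 ∷_) (subcubes g n k d)) (length-subcubes g n k d)
  length-subcubes zero (suc n) k d = begin
    length (List.map (𝟎 ∷_) L₀ ++ List.map (𝟏 ∷_) L₁ ++ List.map (⋆ ∷_) L₂)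
      ≡⟨ trans (length-++ (List.map (𝟎 ∷_) L₀))
               (cong₂ _+_ (length-map (𝟎 ∷_) L₀)
                          (trans (length-++ (List.map (𝟏 ∷_) L₁))
                                 (cong₂ _+_ (length-map (𝟏 ∷_) L₁) (length-map (⋆ ∷_) L₂)))) ⟩
    length L₀ + (length L₁ + length L₂)
      ≡⟨ cong₂ _+_ (length-subcubes zero n k d) (cong₂ _+_ (after-𝟏 d) (after-⋆ k)) ⟩
    cubeCount p n k d + (whenSuc 0 (cubeCount p (n ∸ p) k) d + whenSuc 0 (λ k′ → cubeCount p (n ∸ p) k′ d) k)
      ≡⟨ cubeCount-suc p n k d ⟨
    cubeCount p (suc n) k d ∎
    where
    open ≡-Reasoning
    L₀ L₁ L₂ : List (Pattern n)
    L₀ = subcubes zero n k d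
    L₁ = whenSuc [] (subcubes p n k) d
    L₂ = whenSuc [] (λ k′ → subcubes p n k′ d) k
    after-𝟏 : ∀ d → length (whenSuc [] (subcubes p n k) d) ≡ whenSuc 0 (cubeCount p (n ∸ p) k) d
    after-𝟏 zero = refl
    after-𝟏 (suc d) = length-subcubes p n k d
    after-⋆ : ∀ k → length (whenSuc [] (λ k′ → subcubes p n k′ d) k) ≡ whenSuc 0 (λ k′ → cubeCount p (n ∸ p) k′ d) k
    after-⋆ zero = refl
    after-⋆ (suc k) = length-subcubes p n k d

  ⟦⟧-CubeIn : ∀ {n k d} (P : Pattern n) → Admissible 0 k d P → CubeIn p n k d ⟦ P ⟧
  ⟦⟧-CubeIn P (fib , refl , refl) =
    (λ v v∈P → FibFrom⇒FibString 0 v (FibFrom-⟦⟧ 0 P v v∈P fib)) , ⟦⟧-inducedQ P , ⟦⟧-bottomAt P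

  CubeIn⇒⟦⟧ : ∀ {n k d} (S : VSet n) → CubeIn p n k d S → ∃ λ P → Admissible 0 k d P × SameSet S ⟦ P ⟧
  CubeIn⇒⟦⟧ {d = d} S (S-fib , (f , f-injective , f-∈ , ∈-f , f-Adj) , (b , b∈S , weight-b) , d≤weight)
    with embedding⇒subcube _ f f-injective (λ u w → proj₁ (f-Adj u w))
  ... | P , refl , img = P , (fib , refl , ones≡d) , S≡P
    where
    open IsImage img
    S≡P : SameSet S ⟦ P ⟧
    S≡P v = Bool-ext (λ v∈S → let u , fu≡v = ∈-f v v∈S in subst (_∈⟦ P ⟧) fu≡v (image-∈ u))
                     (λ v∈P → let u , fu≡v = ∈-image v v∈P in subst (λ v → S v ≡ true) fu≡v (f-∈ u))
    ones≡d : ones P ≡ d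
    ones≡d = ≤-antisym (subst (ones P ≤_) weight-b (ones≤weight P b (trans (sym (S≡P b)) b∈S)))
                       (subst (d ≤_) (weight-bottom P) (d≤weight (bottom P) (trans (S≡P (bottom P)) (bottom-∈ P))))
    fib : FibFrom 0 (top P)
    fib = FibString⇒FibFrom 0 (top P) (S-fib (top P) (trans (S≡P (top P)) (top-∈ P))) (λ _ _ → z≤n)

  cubeCount-isCount : ∀ n k d → IsCount (CubeIn p n k d) (cubeCount p n k d)
  cubeCount-isCount n k d =
    List.map ⟦_⟧ (subcubes 0 n k d) ,
    All.map⁺ (All.map (λ {P} → ⟦⟧-CubeIn P) (subcubes-sound 0 n k d)) ,
    complete ,
    AllPairs.map⁺ (AllPairs.map (λ P≢Q same → P≢Q (⟦⟧-injective _ _ same)) (subcubes-unique 0 n k d)) ,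
    trans (length-map ⟦_⟧ (subcubes 0 n k d)) (length-subcubes 0 n k d)
    where
    complete : ∀ S → CubeIn p n k d S → Any (SameSet S) (List.map ⟦_⟧ (subcubes 0 n k d))
    complete S cube with CubeIn⇒⟦⟧ S cube
    ... | P , (fib , refl , refl) , S≡P =
      Any.map (λ ⟦P⟧≡T → subst (SameSet S) ⟦P⟧≡T S≡P) (∈-map⁺ ⟦_⟧ (subcubes-complete 0 P fib))

-- The cube polynomial

∑<-cong : ∀ m {f g : ℕ → ℕ} → (∀ i → i < m → f i ≡ g i) → ∑< m f ≡ ∑< m g
∑<-cong zero _ = refl
∑<-cong (suc m) f≡g = cong₂ _+_ (∑<-cong m λ i i<m → f≡g i (m<n⇒m<1+n i<m)) (f≡g m (n<1+n m))

∑<-+ : ∀ m (f g : ℕ → ℕ) → ∑< m (λ i → f i + g i) ≡ ∑< m f + ∑< m g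
∑<-+ zero f g = refl
∑<-+ (suc m) f g = trans (cong (_+ (f m + g m)) (∑<-+ m f g)) (interchange (∑< m f) (∑< m g) (f m) (g m))

∑<-*ˡ : ∀ m c (f : ℕ → ℕ) → ∑< m (λ i → c * f i) ≡ c * ∑< m f
∑<-*ˡ zero c f = sym (*-zeroʳ c)
∑<-*ˡ (suc m) c f = trans (cong (_+ c * f m) (∑<-*ˡ m c f)) (sym (*-distribˡ-+ c (∑< m f) (f m)))

∑<-suc : ∀ m (f : ℕ → ℕ) → ∑< (suc m) f ≡ f 0 + ∑< m (f ∘ suc)
∑<-suc zero f = +-comm 0 (f 0)
∑<-suc (suc m) f = trans (cong (_+ f (suc m)) (∑<-suc m f)) (+-assoc (f 0) _ _)

∑<-extend : ∀ m t (f : ℕ → ℕ) → (∀ i → m ≤ i → f i ≡ 0) → ∑< (m + t) f ≡ ∑< m f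
∑<-extend m zero f f≡0 = cong (λ l → ∑< l f) (+-identityʳ m)
∑<-extend m (suc t) f f≡0 = begin
  ∑< (m + suc t) f          ≡⟨ cong (λ l → ∑< l f) (+-suc m t) ⟩
  ∑< (m + t) f + f (m + t)  ≡⟨ cong₂ _+_ (∑<-extend m t f f≡0) (f≡0 (m + t) (m≤m+n m t)) ⟩
  ∑< m f + 0                ≡⟨ +-identityʳ _ ⟩
  ∑< m f                    ∎
  where open ≡-Reasoning

∑<-support : ∀ m m′ {f : ℕ → ℕ} → (∀ i → m ≤ i → f i ≡ 0) → (∀ i → m′ ≤ i → f i ≡ 0) → ∑< m f ≡ ∑< m′ f
∑<-support m m′ {f} f≡0 f≡0′ = begin
  ∑< m f         ≡⟨ ∑<-extend m m′ f f≡0 ⟨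
  ∑< (m + m′) f  ≡⟨ cong (λ l → ∑< l f) (+-comm m m′) ⟩
  ∑< (m′ + m) f  ≡⟨ ∑<-extend m′ m f f≡0′ ⟩
  ∑< m′ f        ∎
  where open ≡-Reasoning

∑<-square≡triangle : ∀ N (g : ℕ → ℕ → ℕ) → (∀ k d → N ≤ k + d → g k d ≡ 0) →
                     ∑< N (λ k → ∑< N (g k)) ≡ ∑< N (λ k → ∑< (N ∸ k) (g k))
∑<-square≡triangle N g g≡0 = ∑<-cong N λ k _ →
  ∑<-support N (N ∸ k) (λ d N≤d → g≡0 k d (≤-trans N≤d (m≤n+m d k)))
                       (λ d N∸k≤d → g≡0 k d (≤-trans (m≤n+m∸n N k) (+-monoʳ-≤ k N∸k≤d)))

∑<-triangle≡antidiagonals : ∀ N (g : ℕ → ℕ → ℕ) →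
  ∑< N (λ k → ∑< (N ∸ k) (g k)) ≡ ∑< N (λ a → ∑< (suc a) (λ k → g k (a ∸ k)))
∑<-triangle≡antidiagonals zero g = refl
∑<-triangle≡antidiagonals (suc M) g = begin
  ∑< (suc M) (λ k → ∑< (suc M ∸ k) (g k))
    ≡⟨ ∑<-cong (suc M) (λ k k≤M → cong (λ l → ∑< l (g k)) (+-∸-assoc 1 (s≤s⁻¹ k≤M))) ⟩
  ∑< (suc M) (λ k → ∑< (M ∸ k) (g k) + g k (M ∸ k))
    ≡⟨ ∑<-+ (suc M) (λ k → ∑< (M ∸ k) (g k)) _ ⟩
  ∑< M (λ k → ∑< (M ∸ k) (g k)) + ∑< (M ∸ M) (g M) + antidiagonal
    ≡⟨ cong (λ l → ∑< M (λ k → ∑< (M ∸ k) (g k)) + ∑< l (g M) + antidiagonal) (n∸n≡0 M) ⟩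
  ∑< M (λ k → ∑< (M ∸ k) (g k)) + 0 + antidiagonal
    ≡⟨ cong (_+ antidiagonal) (trans (+-identityʳ _) (∑<-triangle≡antidiagonals M g)) ⟩
  ∑< M (λ a → ∑< (suc a) (λ k → g k (a ∸ k))) + antidiagonal ∎
  where
  open ≡-Reasoning
  antidiagonal : ℕ
  antidiagonal = ∑< (suc M) (λ k → g k (M ∸ k))

∑<≡sum : ∀ m (f : ℕ → ℕ) → ∑< m f ≡ sum {m} (f ∘ toℕ)
∑<≡sum zero f = refl
∑<≡sum (suc m) f = trans (∑<-suc m f) (cong (f 0 +_) (∑<≡sum m (f ∘ suc)))

×ₛ≡* : ∀ m x → m ×ₛ x ≡ m * x
×ₛ≡* zero x = refl
×ₛ≡* (suc m) x = cong (x +_) (×ₛ≡* m x)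

^ₛ≡^ : ∀ x m → x ^ₛ m ≡ x ^ m
^ₛ≡^ x zero = refl
^ₛ≡^ x (suc m) = cong (x *_) (^ₛ≡^ x m)

binomial : ∀ x y a → ∑< (suc a) (λ k → (a C k) * x ^ k * y ^ (a ∸ k)) ≡ (x + y) ^ a
binomial x y a = begin
  ∑< (suc a) (λ k → (a C k) * x ^ k * y ^ (a ∸ k))              ≡⟨ ∑<≡sum (suc a) _ ⟩
  sum {suc a} (λ k → (a C toℕ k) * x ^ toℕ k * y ^ (a ∸ toℕ k)) ≡⟨ sum-cong-≗ {suc a} term ⟩
  Binomial.binomialExpansion x y a                              ≡⟨ Binomial.theorem a x y ⟨
  (x + y) ^ₛ a                                                  ≡⟨ ^ₛ≡^ (x + y) a ⟩
  (x + y) ^ a                                                   ∎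
  where
  open ≡-Reasoning
  term : ∀ (k : Fin (suc a)) → (a C toℕ k) * x ^ toℕ k * y ^ (a ∸ toℕ k) ≡ Binomial.binomialTerm x y a k
  term k = begin
    (a C toℕ k) * x ^ toℕ k * y ^ (a ∸ toℕ k)       ≡⟨ *-assoc (a C toℕ k) _ _ ⟩
    (a C toℕ k) * (x ^ toℕ k * y ^ (a ∸ toℕ k))     ≡⟨ cong₂ (λ u v → (a C toℕ k) * (u * v)) (^ₛ≡^ x (toℕ k)) (^ₛ≡^ y (a ∸ toℕ k)) ⟨
    (a C toℕ k) * (x ^ₛ toℕ k * y ^ₛ (a ∸ toℕ k))   ≡⟨ ×ₛ≡* (a C toℕ k) _ ⟨
    Binomial.binomialTerm x y a k                   ∎

Deval-cubeCount : ∀ p n x q → Deval n (cubeCount p n) x q ≡ Rhs p n x q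
Deval-cubeCount p n x q = begin
  ∑< (suc n) (λ k → ∑< (suc n) (term k))                   ≡⟨ ∑<-square≡triangle (suc n) term term≡0 ⟩
  ∑< (suc n) (λ k → ∑< (suc n ∸ k) (term k))               ≡⟨ ∑<-triangle≡antidiagonals (suc n) term ⟩
  ∑< (suc n) (λ a → ∑< (suc a) (λ k → term k (a ∸ k)))     ≡⟨ ∑<-cong (suc n) (λ a _ → antidiagonal a) ⟩
  ∑< (suc n) layer                                         ≡⟨ ∑<-support (suc n) (suc ((n + p) / suc p))
                                                                (λ a n<a → layer≡0 a (fibCount-vanish-< p n a n<a))
                                                                (λ a lt → layer≡0 a (fibCount-vanish-/ p n a lt)) ⟩
  ∑< (suc ((n + p) / suc p)) layer                         ∎
  where
  open ≡-Reasoning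
  term : ℕ → ℕ → ℕ
  term k d = cubeCount p n k d * x ^ k * q ^ d
  term≡0 : ∀ k d → suc n ≤ k + d → term k d ≡ 0
  term≡0 k d n<k+d = cong (λ c → c * x ^ k * q ^ d) (cubeCount-vanish p n k d n<k+d)
  layer : ℕ → ℕ
  layer a = fibCount p n a * (q + x) ^ a
  layer≡0 : ∀ a → fibCount p n a ≡ 0 → layer a ≡ 0
  layer≡0 a fib≡0 = cong (_* (q + x) ^ a) fib≡0
  antidiagonal : ∀ a → ∑< (suc a) (λ k → term k (a ∸ k)) ≡ layer a
  antidiagonal a = begin
    ∑< (suc a) (λ k → term k (a ∸ k))                                  ≡⟨ ∑<-cong (suc a) split ⟩
    ∑< (suc a) (λ k → fibCount p n a * ((a C k) * x ^ k * q ^ (a ∸ k)))  ≡⟨ ∑<-*ˡ (suc a) (fibCount p n a) _ ⟩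
    fibCount p n a * ∑< (suc a) (λ k → (a C k) * x ^ k * q ^ (a ∸ k))   ≡⟨ cong (fibCount p n a *_) (binomial x q a) ⟩
    fibCount p n a * (x + q) ^ a                                       ≡⟨ cong (λ y → fibCount p n a * y ^ a) (+-comm x q) ⟩
    layer a                                                            ∎
    where
    reassoc : ∀ f c X Q → f * c * X * Q ≡ f * (c * X * Q)
    reassoc f c X Q = trans (cong (_* Q) (*-assoc f c X)) (*-assoc f (c * X) Q)
    split : ∀ k → k < suc a → term k (a ∸ k) ≡ fibCount p n a * ((a C k) * x ^ k * q ^ (a ∸ k))
    split k k≤a = trans (cong (λ m → fibCount p n m * (m C k) * x ^ k * q ^ (a ∸ k)) (m+[n∸m]≡n (s≤s⁻¹ k≤a)))
                        (reassoc (fibCount p n a) (a C k) (x ^ k) (q ^ (a ∸ k)))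

theorem5p5 : (p n : ℕ) → 1 ≤ p →
    Σ (ℕ → ℕ → ℕ) λ c →
        ((k d : ℕ) → IsCount (CubeIn p n k d) (c k d))
      × ((k d : ℕ) → n < k + d → c k d ≡ 0)
      × ((x q : ℕ) → Deval n c x q ≡ Rhs p n x q)
      × ((k d : ℕ) → c k d ≡ ((n + p ∸ (k + d) * p) C (k + d)) * ((k + d) C k))
theorem5p5 p n _ =
  cubeCount p n , Subcubes.cubeCount-isCount p n , cubeCount-vanish p n , Deval-cubeCount p n , λ k d → refl
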